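{- Every Fraser graph is contracted.
   Context: An $r$-hourglass plabic graph is a bipartite planar graph in a disk with fixed black–white coloring and positive integer edge multiplicities (an edge of multiplicity $m$ being an $m$-hourglass), every internal vertex of degree $r$ counted with multiplicity, boundary vertices of simple degree one. A contraction move deletes an internal vertex of simple degree 2 joined by an $a$-hourglass and an $(r-a)$-hourglass to two internal vertices $u,u'$ of the opposite color and identifies $u$ with $u'$; the graph is contracted if no contraction move applies. Fraser's map: for a standard Young tableau $T$ of shape $r\times2$, $\mathfrak M(T)$ is the noncrossing perfect matching of $[2r]$ with each first-column entry the smaller of its pair. With $i_1,\dots,i_s$ (cyclic order) the $i$ such that $i,i+1\pmod{2r}$ are matched, claw sets are the cyclic intervals $C_j=(i_j,i_{j+1}]$. Form an $s$-gon on $\delta_1,\dots,\delta_s$ with edge $\delta_j\delta_k$ of weight the number of arcs between $C_j$ and $C_k$; add weight-0 diagonals to obtain a weighted triangulation. $\mathcal F(T)$ has black boundary vertices $b_1,\dots,b_{2r}$, white internal vertices $w(\delta_j)$ joined by simple edges to $b_k$ for $k\in C_j$, and for each triangle $\Delta$ a black internal vertex $b(\Delta)$ joined to the white vertex of each corner $\delta$ of $\Delta$ with multiplicity the total weight of the edges in the part of the triangulation cut off by the side of $\Delta$ opposite $\delta$ (away from $\Delta$), including that side (edges of multiplicity 0 omitted). A Fraser graph is any graph so obtained. -}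

module Defs where

open import Data.Nat using (ℕ; zero; suc; _+_; _*_; _∸_; _≤_; _<_; _<ᵇ_; _≤ᵇ_; _<?_)
open import Data.Fin using (Fin; zero; suc; toℕ; fromℕ<; _≟_)
open import Data.Bool using (Bool; true; false; if_then_else_; _∧_; _∨_; not)
open import Data.List using (List; map; allFin)
open import Data.Nat.ListAction using (sum)
open import Data.Product using (Σ; ∃; _×_; _,_)
open import Data.Sum using (_⊎_)
open import Relation.Nullary using (¬_; yes; no; does)
open import Relation.Binary.PropositionalEquality using (_≡_; _≢_)
open import Function.Bundles using (_⇔_)

-- Conventions: the points 1..2r of the paper are represented by
-- Fin (2 * r) = {0, …, 2r-1} (label k+1 ↦ k); the polygon vertices
-- δ_1..δ_s by Fin s.

_<F_ : ∀ {n} → Fin n → Fin n → Set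
i <F j = toℕ i < toℕ j

cnext : ∀ {n} → Fin n → Fin n
cnext {suc m} i with suc (toℕ i) <? suc m
... | yes p = fromℕ< p
... | no _  = zero

sumFin : (n : ℕ) → (Fin n → ℕ) → ℕ
sumFin n f = sum (map f (allFin n))

countFin : (n : ℕ) → (Fin n → Bool) → ℕ
countFin n P = sumFin n (λ x → if P x then 1 else 0)

inOpenClosed : ∀ {n} → Fin n → Fin n → Fin n → Bool
inOpenClosed a b k =
  if toℕ a <ᵇ toℕ b
  then (toℕ a <ᵇ toℕ k) ∧ (toℕ k ≤ᵇ toℕ b)
  else (toℕ a <ᵇ toℕ k) ∨ (toℕ k ≤ᵇ toℕ b)

inClosed : ∀ {n} → Fin n → Fin n → Fin n → Bool
inClosed a b k =
  if toℕ a ≤ᵇ toℕ b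
  then (toℕ a ≤ᵇ toℕ k) ∧ (toℕ k ≤ᵇ toℕ b)
  else (toℕ a ≤ᵇ toℕ k) ∨ (toℕ k ≤ᵇ toℕ b)

-- A graph with vertex 2-colouring, internal/boundary marking, and edge
-- multiplicities: mult u v = m > 0 means an m-hourglass between u and v,
-- mult u v = 0 means no edge.
record HGraph : Set₁ where
  field
    V        : Set
    internal : V → Bool
    black    : V → Bool
    mult     : V → V → ℕ

ContractionAt : (r : ℕ) (G : HGraph) → HGraph.V G → Set
ContractionAt r G v =
  internal v ≡ true ×
  Σ V λ u → Σ V λ u' →
    u ≢ u' ×
    internal u ≡ true × internal u' ≡ true ×
    black u ≢ black v × black u' ≢ black v ×
    Σ ℕ (λ a → 1 ≤ a × a < r × mult v u ≡ a × mult v u' ≡ r ∸ a) ×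
    (∀ x → 0 < mult v x → x ≡ u ⊎ x ≡ u')
  where open HGraph G

Contracted : (r : ℕ) → HGraph → Set
Contracted r G = ∀ v → ¬ ContractionAt r G v

record SYT (r : ℕ) : Set where
  field
    entry     : Fin r → Fin 2 → Fin (2 * r)
    injective : ∀ i c i' c' → entry i c ≡ entry i' c' → (i ≡ i' × c ≡ c')
    surjective : ∀ k → Σ (Fin r) λ i → Σ (Fin 2) λ c → entry i c ≡ k
    rowIncr   : ∀ i → entry i zero <F entry i (suc zero)
    colIncr   : ∀ i i' c → i <F i' → entry i c <F entry i' c

InFirstColumn : ∀ {r} → SYT r → Fin (2 * r) → Set
InFirstColumn T k = Σ _ λ i → SYT.entry T i zero ≡ k

record NCPM (n : ℕ) : Set where
  field
    μ          : Fin n → Fin n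
    involutive : ∀ k → μ (μ k) ≡ k
    noFixed    : ∀ k → μ k ≢ k
    noncrossing : ∀ a b c d → a <F b → b <F c → c <F d → μ a ≡ c → μ b ≢ d

-- μ is Fraser's matching 𝔐(T): each first-column entry is the smaller
-- element of its pair (this characterises 𝔐(T) uniquely).
IsFraserMatching : ∀ {r} → SYT r → NCPM (2 * r) → Set
IsFraserMatching T M = ∀ k → InFirstColumn T k → k <F NCPM.μ M k

-- ι : Fin s → Fin (2r) lists i_1 < … < i_s, exactly the i with
-- i, i+1 (mod 2r) matched.
ClawIndexing : ∀ {n} → NCPM n → (s : ℕ) → (Fin s → Fin n) → Set
ClawIndexing {n} M s ι =
  (∀ j j' → j <F j' → ι j <F ι j') ×
  (∀ (i : Fin n) → (NCPM.μ M i ≡ cnext i) ⇔ (Σ (Fin s) λ j → ι j ≡ i))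

inClaw : ∀ {n s} → (Fin s → Fin n) → Fin s → Fin n → Bool
inClaw ι j k = inOpenClosed (ι j) (ι (cnext j)) k

weight : ∀ {n s} → NCPM n → (Fin s → Fin n) → Fin s → Fin s → ℕ
weight {n} M ι p q = countFin n (λ a → inClaw ι p a ∧ inClaw ι q (NCPM.μ M a))

Crosses : ∀ {s} → Fin s → Fin s → Fin s → Fin s → Set
Crosses a c b d = (a <F b × b <F c × c <F d) ⊎ (b <F a × a <F d × d <F c)

-- E p q = true iff δ_p δ_q is an edge (side or diagonal) of the
-- triangulation; all positive-weight pairs must be edges.
record WeightedTriangulation {n s : ℕ} (M : NCPM n) (ι : Fin s → Fin n)
                             (E : Fin s → Fin s → Bool) : Set where
  field
    symm        : ∀ p q → E p q ≡ E q p
    irrefl      : ∀ p → E p p ≡ false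
    sides       : ∀ j → E j (cnext j) ≡ true
    noncrossing : ∀ a b c d → a <F b → b <F c → c <F d →
                  E a c ≡ true → E b d ≡ false
    maximal     : ∀ a c → a <F c → E a c ≡ false →
                  Σ (Fin s) λ b → Σ (Fin s) λ d →
                    b <F d × E b d ≡ true × Crosses a c b d
    weighted    : ∀ p q → p ≢ q → 0 < weight M ι p q → E p q ≡ true

record Triangle {s : ℕ} (E : Fin s → Fin s → Bool) : Set where
  constructor tri
  field
    a b c : Fin s
    a<b   : a <F b
    b<c   : b <F c
    eab   : E a b ≡ true
    ebc   : E b c ≡ true
    eac   : E a c ≡ true

regionWeight : ∀ {n s} → NCPM n → (Fin s → Fin n) → Fin s → Fin s → ℕ
regionWeight {s = s} M ι x y =
  sumFin s λ p → sumFin s λ q →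
    if (toℕ p <ᵇ toℕ q) ∧ inClosed x y p ∧ inClosed x y q
    then weight M ι p q else 0

-- multiplicity of the edge b(Δ) — w(δ_j): for the corner a the part cut
-- off by the opposite side {b,c} is [b,c]; for b it is [c,a]; for c, [a,b].
cornerMult : ∀ {n s} (M : NCPM n) (ι : Fin s → Fin n)
             {E : Fin s → Fin s → Bool} → Triangle E → Fin s → ℕ
cornerMult M ι (tri a b c _ _ _ _ _) j =
  if does (j ≟ a) then regionWeight M ι b c
  else if does (j ≟ b) then regionWeight M ι c a
  else if does (j ≟ c) then regionWeight M ι a b
  else 0

data FVertex (n s : ℕ) (E : Fin s → Fin s → Bool) : Set where
  bdry : Fin n → FVertex n s E
  wht  : Fin s → FVertex n s E
  blk  : Triangle E → FVertex n s E

fraserGraph : (r : ℕ) → NCPM (2 * r) → (s : ℕ) → (Fin s → Fin (2 * r)) →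
              (Fin s → Fin s → Bool) → HGraph
fraserGraph r M s ι E = record
  { V = FVertex (2 * r) s E
  ; internal = int
  ; black = blck
  ; mult = m
  }
  where
    int : FVertex (2 * r) s E → Bool
    int (bdry _) = false
    int (wht _)  = true
    int (blk _)  = true
    blck : FVertex (2 * r) s E → Bool
    blck (bdry _) = true
    blck (wht _)  = false
    blck (blk _)  = true
    m : FVertex (2 * r) s E → FVertex (2 * r) s E → ℕ
    m (bdry k) (wht j) = if inClaw ι j k then 1 else 0
    m (wht j) (bdry k) = if inClaw ι j k then 1 else 0
    m (wht j) (blk t)  = cornerMult M ι t j
    m (blk t) (wht j)  = cornerMult M ι t j
    m _ _ = 0

{-# OPTIONS --safe #-}
-- A vertex admitting a contraction move has at most two neighbours, all of
-- them internal.  A white vertex w(δ_j) is joined to the boundary vertex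
-- b_{i_{j+1}}, since i_{j+1} ∈ C_j.  A black vertex b(Δ) has three distinct
-- white neighbours: each side of Δ cuts off a part of the triangulation
-- containing a side δ_p δ_{p+1} of the polygon, and such a side has positive
-- weight because the arc {i_{p+1}, i_{p+1}+1} joins C_p to C_{p+1}.
module Submission where

open import Defs
open import Data.Nat using (ℕ; _*_)
open import Data.Fin using (Fin)
open import Data.Bool using (Bool)

open import Data.Nat using (suc; _<_; _≤_; _<ᵇ_; _≤ᵇ_; _<?_; z≤n; z<s; s≤s⁻¹)
open import Data.Nat.Properties
  using (<⇒<ᵇ; ≤⇒≤ᵇ; <ᵇ-reflects-<; ≤ᵇ-reflects-≤; ≤-refl; ≤-trans;
         ≤-<-trans; <-≤-trans; n≤1+n; ≮⇒≥; ≰⇒>; ≤∧≢⇒<; 1+n≢n; n≤0⇒n≡0;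
         m≤m+n; m≤n+m; module ≤-Reasoning)
open import Data.Fin using (toℕ; _≟_)
open import Data.Fin.Properties using (toℕ-fromℕ<; toℕ<n; toℕ-injective; <⇒≢; <-cmp; <-trans)
open import Data.Bool using (true; false; if_then_else_; _∧_)
open import Data.Bool.Properties using (T-≡; ∨-zeroʳ)
open import Data.List using (List; _∷_; map)
open import Data.List.Membership.Propositional using (_∈_)
open import Data.List.Membership.Propositional.Properties using (∈-allFin)
open import Data.List.Relation.Unary.Any using (here; there)
open import Data.Nat.ListAction using (sum)
open import Data.Product using (_×_; _,_; proj₁; proj₂)
open import Data.Sum using (_⊎_; inj₁; inj₂)
open import Function using (_∘_)
open import Function.Bundles using (Equivalence)
open import Relation.Binary.Definitions using (tri<; tri≈; tri>)
open import Relation.Nullary using (¬_; yes; no; contradiction)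
open import Relation.Nullary.Decidable using (dec-true; dec-false)
open import Relation.Nullary.Reflects using (ofʸ; ofⁿ)
open import Relation.Binary.PropositionalEquality

<⇒<ᵇ≡true : ∀ {m n} → m < n → (m <ᵇ n) ≡ true
<⇒<ᵇ≡true = Equivalence.to T-≡ ∘ <⇒<ᵇ

≤⇒≤ᵇ≡true : ∀ {m n} → m ≤ n → (m ≤ᵇ n) ≡ true
≤⇒≤ᵇ≡true = Equivalence.to T-≡ ∘ ≤⇒≤ᵇ

indicator-pos : ∀ {b} → b ≡ true → 0 < (if b then 1 else 0)
indicator-pos refl = z<s

toℕ-cnext-< : ∀ {n} (i : Fin n) → suc (toℕ i) < n → toℕ (cnext i) ≡ suc (toℕ i)
toℕ-cnext-< {suc m} i i+1<n with suc (toℕ i) <? suc m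
... | yes i+1<n′ = toℕ-fromℕ< i+1<n′
... | no  i+1≮n  = contradiction i+1<n i+1≮n

toℕ-cnext-≮ : ∀ {n} (i : Fin n) → ¬ suc (toℕ i) < n → toℕ (cnext i) ≡ 0
toℕ-cnext-≮ {suc m} i i+1≮n with suc (toℕ i) <? suc m
... | yes i+1<n = contradiction i+1<n i+1≮n
... | no  _     = refl

cnext-≢ : ∀ {n} {x y : Fin n} → x ≢ y → cnext x ≢ x
cnext-≢ {n} {x} {y} x≢y x′≡x with suc (toℕ x) <? n
... | yes x+1<n = 1+n≢n (trans (sym (toℕ-cnext-< x x+1<n)) (cong toℕ x′≡x))
... | no  x+1≮n = x≢y (toℕ-injective (trans x≡0 (sym y≡0)))
  where
    x≡0 : toℕ x ≡ 0
    x≡0 = trans (sym (cong toℕ x′≡x)) (toℕ-cnext-≮ x x+1≮n)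
    n≤1 : n ≤ 1
    n≤1 = subst (λ k → n ≤ suc k) x≡0 (≮⇒≥ x+1≮n)
    y≡0 : toℕ y ≡ 0
    y≡0 = n≤0⇒n≡0 (s≤s⁻¹ (<-≤-trans (toℕ<n y) n≤1))

inOpenClosed-intro : ∀ {n m} (a b k : Fin n) → toℕ k ≡ m →
  (toℕ a < toℕ b → toℕ a < m × m ≤ toℕ b) →
  (¬ toℕ a < toℕ b → toℕ a < m ⊎ m ≤ toℕ b) →
  inOpenClosed a b k ≡ true
inOpenClosed-intro a b k refl inside outside
  with toℕ a <ᵇ toℕ b | <ᵇ-reflects-< (toℕ a) (toℕ b)
... | true  | ofʸ a<b =
  cong₂ _∧_ (<⇒<ᵇ≡true (proj₁ (inside a<b))) (≤⇒≤ᵇ≡true (proj₂ (inside a<b)))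
... | false | ofⁿ a≮b with outside a≮b
...   | inj₁ a<k rewrite <⇒<ᵇ≡true a<k = refl
...   | inj₂ k≤b rewrite ≤⇒≤ᵇ≡true k≤b = ∨-zeroʳ _

inClosed-intro : ∀ {n m} (a b k : Fin n) → toℕ k ≡ m →
  (toℕ a ≤ toℕ b → toℕ a ≤ m × m ≤ toℕ b) →
  (toℕ b < toℕ a → toℕ a ≤ m ⊎ m ≤ toℕ b) →
  inClosed a b k ≡ true
inClosed-intro a b k refl inside outside
  with toℕ a ≤ᵇ toℕ b | ≤ᵇ-reflects-≤ (toℕ a) (toℕ b)
... | true  | ofʸ a≤b =
  cong₂ _∧_ (≤⇒≤ᵇ≡true (proj₁ (inside a≤b))) (≤⇒≤ᵇ≡true (proj₂ (inside a≤b)))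
... | false | ofⁿ a≰b with outside (≰⇒> a≰b)
...   | inj₁ a≤k rewrite ≤⇒≤ᵇ≡true a≤k = refl
...   | inj₂ k≤b rewrite ≤⇒≤ᵇ≡true k≤b = ∨-zeroʳ _

inOpenClosed-end : ∀ {n} (a b : Fin n) → inOpenClosed a b b ≡ true
inOpenClosed-end a b = inOpenClosed-intro a b b refl (λ a<b → a<b , ≤-refl) (λ _ → inj₂ ≤-refl)

inOpenClosed-cnext : ∀ {n} (a b : Fin n) → inOpenClosed a b (cnext a) ≡ true
inOpenClosed-cnext {n} a b with suc (toℕ a) <? n
... | yes a+1<n = inOpenClosed-intro a b (cnext a) (toℕ-cnext-< a a+1<n)
                    (λ a<b → ≤-refl , a<b) (λ _ → inj₁ ≤-refl)
... | no  a+1≮n = inOpenClosed-intro a b (cnext a) (toℕ-cnext-≮ a a+1≮n)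
                    (λ a<b → contradiction (≤-<-trans a<b (toℕ<n b)) a+1≮n) (λ _ → inj₂ z≤n)

inClosed-start : ∀ {n} (a b : Fin n) → inClosed a b a ≡ true
inClosed-start a b = inClosed-intro a b a refl (λ a≤b → ≤-refl , a≤b) (λ _ → inj₁ ≤-refl)

inClosed-cnext : ∀ {n} {a b : Fin n} → a ≢ b → inClosed a b (cnext a) ≡ true
inClosed-cnext {n} {a} {b} a≢b with suc (toℕ a) <? n
... | yes a+1<n = inClosed-intro a b (cnext a) (toℕ-cnext-< a a+1<n)
                    (λ a≤b → n≤1+n _ , ≤∧≢⇒< a≤b (a≢b ∘ toℕ-injective)) (λ _ → inj₁ (n≤1+n _))
... | no  a+1≮n = inClosed-intro a b (cnext a) (toℕ-cnext-≮ a a+1≮n)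
                    (λ a≤b → contradiction
                       (≤-<-trans (≤∧≢⇒< a≤b (a≢b ∘ toℕ-injective)) (toℕ<n b)) a+1≮n)
                    (λ _ → inj₂ z≤n)

∈⇒≤sum : ∀ {A : Set} (f : A → ℕ) {x : A} {xs : List A} → x ∈ xs → f x ≤ sum (map f xs)
∈⇒≤sum f (here refl) = m≤m+n _ _
∈⇒≤sum f {xs = y ∷ ys} (there x∈ys) = ≤-trans (∈⇒≤sum f x∈ys) (m≤n+m _ (f y))

≤sumFin : ∀ {n} (f : Fin n → ℕ) (x : Fin n) → f x ≤ sumFin n f
≤sumFin f x = ∈⇒≤sum f (∈-allFin x)

countFin-pos : ∀ {n} (P : Fin n → Bool) {x : Fin n} → P x ≡ true → 0 < countFin n P
countFin-pos P {x} Px = <-≤-trans (indicator-pos Px) (≤sumFin _ x)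

clawIndexing⇒claw-ends-matched : ∀ {n s} {M : NCPM n} {ι : Fin s → Fin n} →
  ClawIndexing M s ι → ∀ j → NCPM.μ M (ι j) ≡ cnext (ι j)
clawIndexing⇒claw-ends-matched {ι = ι} (_ , matched⇔claw-end) j =
  Equivalence.from (matched⇔claw-end (ι j)) (j , refl)

module _ {n s : ℕ} (M : NCPM n) (ι : Fin s → Fin n) where
  open NCPM M

  weight-pos : ∀ {p q} k → inClaw ι p k ≡ true → inClaw ι q (μ k) ≡ true → 0 < weight M ι p q
  weight-pos {p} {q} k p∋k q∋μk =
    countFin-pos (λ a → inClaw ι p a ∧ inClaw ι q (μ a)) {k} (cong₂ _∧_ p∋k q∋μk)

  weight≤regionWeight : ∀ x y {p q} → toℕ p < toℕ q →
    inClosed x y p ≡ true → inClosed x y q ≡ true → weight M ι p q ≤ regionWeight M ι x y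
  weight≤regionWeight x y {p} {q} p<q x∋p x∋q = begin
    weight M ι p q          ≡⟨ cong (λ b → if b then weight M ι p q else 0)
                                    (cong₂ _∧_ (<⇒<ᵇ≡true p<q) (cong₂ _∧_ x∋p x∋q)) ⟨
    summand p q             ≤⟨ ≤sumFin (summand p) q ⟩
    sumFin s (summand p)    ≤⟨ ≤sumFin (sumFin s ∘ summand) p ⟩
    regionWeight M ι x y    ∎
    where
      open ≤-Reasoning
      summand : Fin s → Fin s → ℕ
      summand p′ q′ = if (toℕ p′ <ᵇ toℕ q′) ∧ inClosed x y p′ ∧ inClosed x y q′
                      then weight M ι p′ q′ else 0

  module _ (claw-ends-matched : ∀ j → μ (ι j) ≡ cnext (ι j)) where

    weight-cnext-pos : ∀ j → 0 < weight M ι j (cnext j)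
    weight-cnext-pos j = weight-pos k (inOpenClosed-end (ι j) k)
      (subst (λ i → inClaw ι (cnext j) i ≡ true) (sym (claw-ends-matched (cnext j)))
             (inOpenClosed-cnext k (ι (cnext (cnext j)))))
      where k = ι (cnext j)

    weight-cnext-pos˘ : ∀ j → 0 < weight M ι (cnext j) j
    weight-cnext-pos˘ j = weight-pos (cnext k) (inOpenClosed-cnext k (ι (cnext (cnext j))))
      (subst (λ i → inClaw ι j i ≡ true) (sym μk′≡k) (inOpenClosed-end (ι j) k))
      where
        k = ι (cnext j)
        μk′≡k : μ (cnext k) ≡ k
        μk′≡k = trans (cong μ (sym (claw-ends-matched (cnext j)))) (involutive k)

    regionWeight-pos : ∀ {x y} → x ≢ y → 0 < regionWeight M ι x y
    regionWeight-pos {x} {y} x≢y with <-cmp x (cnext x)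
    ... | tri< x<x′ _ _ = <-≤-trans (weight-cnext-pos x)
                            (weight≤regionWeight x y x<x′ (inClosed-start x y) (inClosed-cnext x≢y))
    ... | tri≈ _ x≡x′ _ = contradiction (sym x≡x′) (cnext-≢ x≢y)
    ... | tri> _ _ x′<x = <-≤-trans (weight-cnext-pos˘ x)
                            (weight≤regionWeight x y x′<x (inClosed-cnext x≢y) (inClosed-start x y))

    cornerMult-pos : ∀ {E} (t : Triangle E) → let open Triangle t in
      0 < cornerMult M ι t a × 0 < cornerMult M ι t b × 0 < cornerMult M ι t c
    cornerMult-pos (tri a b c a<b b<c _ _ _)
      rewrite dec-true (a ≟ a) refl | dec-false (b ≟ a) (<⇒≢ a<b ∘ sym) | dec-true (b ≟ b) refl
            | dec-false (c ≟ a) (<⇒≢ (<-trans a<b b<c) ∘ sym) | dec-false (c ≟ b) (<⇒≢ b<c ∘ sym)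
            | dec-true (c ≟ c) refl
      = regionWeight-pos (<⇒≢ b<c)
      , regionWeight-pos (<⇒≢ (<-trans a<b b<c) ∘ sym)
      , regionWeight-pos (<⇒≢ a<b)

module _ {r : ℕ} (G : HGraph) (v : HGraph.V G) where
  open HGraph G

  external-neighbour⇒¬contractionAt : ∀ x → 0 < mult v x → internal x ≡ false →
    ¬ ContractionAt r G v
  external-neighbour⇒¬contractionAt x v~x x-external
    (_ , u , u′ , _ , u-internal , u′-internal , _ , _ , _ , only-u-u′) with only-u-u′ x v~x
  ... | inj₁ refl = contradiction (trans (sym x-external) u-internal) λ ()
  ... | inj₂ refl = contradiction (trans (sym x-external) u′-internal) λ ()

  three-neighbours⇒¬contractionAt : ∀ x y z → x ≢ y → y ≢ z → x ≢ z →
    0 < mult v x → 0 < mult v y → 0 < mult v z → ¬ ContractionAt r G v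
  three-neighbours⇒¬contractionAt x y z x≢y y≢z x≢z v~x v~y v~z
    (_ , u , u′ , _ , _ , _ , _ , _ , _ , only-u-u′)
    with only-u-u′ x v~x | only-u-u′ y v~y | only-u-u′ z v~z
  ... | inj₁ refl | inj₁ refl | _         = x≢y refl
  ... | inj₂ refl | inj₂ refl | _         = x≢y refl
  ... | inj₁ refl | inj₂ refl | inj₁ refl = x≢z refl
  ... | inj₁ refl | inj₂ refl | inj₂ refl = y≢z refl
  ... | inj₂ refl | inj₁ refl | inj₁ refl = y≢z refl
  ... | inj₂ refl | inj₁ refl | inj₂ refl = x≢z refl

wht-injective : ∀ {n s E} {i j : Fin s} → wht {n} {s} {E} i ≡ wht j → i ≡ j
wht-injective refl = refl

proposition4p7 : (r : ℕ) (T : SYT r) (M : NCPM (2 * r)) → IsFraserMatching T M →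
    (s : ℕ) (ι : Fin s → Fin (2 * r)) → ClawIndexing M s ι →
    (E : Fin s → Fin s → Bool) → WeightedTriangulation M ι E →
    Contracted r (fraserGraph r M s ι E)
proposition4p7 r _ M _ s ι claws E _ (bdry _) (() , _)
proposition4p7 r _ M _ s ι claws E _ (wht j) =
  external-neighbour⇒¬contractionAt (fraserGraph r M s ι E) (wht j) (bdry (ι (cnext j)))
    (indicator-pos (inOpenClosed-end (ι j) (ι (cnext j)))) refl
proposition4p7 r _ M _ s ι claws E _ (blk t@(tri a b c a<b b<c _ _ _))
  with a-pos , b-pos , c-pos ← cornerMult-pos M ι (clawIndexing⇒claw-ends-matched {M = M} claws) t =
  three-neighbours⇒¬contractionAt (fraserGraph r M s ι E) (blk t) (wht a) (wht b) (wht c)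
    (<⇒≢ a<b ∘ wht-injective) (<⇒≢ b<c ∘ wht-injective) (<⇒≢ (<-trans a<b b<c) ∘ wht-injective)
    a-pos b-pos c-pos
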